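{- On terms, the reflexive transitive closure of standard reduction equals the composite relation (read left to right) $$\rightarrowtail_{\mathrm{rt}}\;=\;\overset{A}{\rightarrowtail}_{\mathrm{rt}}\;\overset{B}{\rightarrowtail}_{\mathrm{rt}}\;\overset{C}{\rightarrowtail}_{\mathrm{rt}}\Big(\overset{D}{\rightarrowtail}_{\mathrm{r}}\;\cup\;\overset{E}{\rightarrowtail}_{\mathrm{r}}\;\overset{A}{\rightarrowtail}_{\mathrm{rt}}\Big),$$ i.e. every standard reduction sequence from a term consists of zero or more standard A-steps, then zero or more standard B-steps, then zero or more standard C-steps, then either at most one standard D-step, or at most one standard E-step followed by zero or more standard A-steps (and conversely every such composite is a standard reduction sequence).
   Context: The type theory $\mathrm{Catt}_{\mathrm{su}}$ (raw syntax). Fix an infinite set $V$ of variables containing distinct $d_i,d_i'$ ($i\in\mathbb N$). Contexts $\Gamma::=\emptyset\mid\Gamma,x:A$; types $A::=\star\mid s\to_A t$; terms $t::=x\mid\mathsf{coh}(\Gamma:A)[\sigma]$; substitutions $\sigma::=\langle\rangle\mid\langle\sigma,x\mapsto t\rangle$. $\equiv$ is syntactic equality up to $\alpha$-equivalence. Substitution: $\star[\sigma]=\star$, $(s\to_A t)[\sigma]=s[\sigma]\to_{A[\sigma]}t[\sigma]$, $x[\sigma]$ the entry for $x$, $\mathsf{coh}(\Gamma:A)[\tau][\sigma]=\mathsf{coh}(\Gamma:A)[\tau\circ\sigma]$, $\langle\rangle\circ\sigma=\langle\rangle$, $\langle\tau,x\mapsto t\rangle\circ\sigma=\langle\tau\circ\sigma,x\mapsto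 t[\sigma]\rangle$. $\dim\star=-1$, $\dim(s\to_A t)=\dim A+1$. Pasting contexts are derived linearly by: $(x:\star)\vdash_p x:\star$; $\Gamma\vdash_p x:A\Rightarrow\Gamma,y:A,f:x\to_A y\vdash_p f:x\to_A y$ (introduction); $\Gamma\vdash_p f:x\to_A y\Rightarrow\Gamma\vdash_p y:A$ (descent); ending at a variable of type $\star$. Locally maximal variables: those introduced by an introduction step immediately followed by a descent step. Discs: $D^0=(d_0:\star)$, $S^{ -1}=\star$, $D^{k+1}=D^k,(d_k':S^{k-1}),(d_{k+1}:S^k)$, $S^k=d_k\to_{S^{k-1}}d_k'$; $\mathsf{i}_k:=\mathsf{coh}(D^k:d_k\to_{S^{k-1}}d_k)[\mathrm{id}_{D^k}]$; a term is an identity if syntactically $\mathsf{i}_k[\tau]$. $\{\star,t\}=\langle t\rangle$, $\{u\to_A v,t\}=\langle\{A,u\},v,t\rangle$. For locally maximal $\alpha:s\to_A t$ of $\Delta$: $\Delta/\!\!/\alpha$ deletes $t,\alpha$; $\pi_\alpha$ sends $\alpha\mapsto\mathsf{i}_{\dim A+1}[\{A,s\}]$, $t\mapsto s$, others fixed; $\sigma/\!\!/\alpha$ removes the entries for $t,\alpha$. Standard reduction $\rightarrowtail$ (partial function, mutual induction): $\star$ and variables do not reduce; a type $u\to_T v$ reduces $T$ if possible, else $u$, else $v$; a substitution reduces its leftmost reducible entry; a coherence $t\equiv\mathsf{coh}(\Gamma:U)[\sigma]$ reduces by the first applicable clause: (A) $\sigma\rightarrowtail\tilde\sigma$ gives $\mathsf{coh}(\Gamma:U)[\tilde\sigma]$;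 (B) if $t$ is not an identity and $x$ is the leftmost locally maximal variable of $\Gamma$ with $x[\sigma]$ an identity, gives $\mathsf{coh}(\Gamma/\!\!/x:U[\pi_x])[\sigma/\!\!/x]$; (C) $U\rightarrowtail\tilde U$ gives $\mathsf{coh}(\Gamma:\tilde U)[\sigma]$; (D) if $\Gamma\equiv D^{n+1}$ and $U\equiv S^n$, gives the last entry of $\sigma$; (E) if $t$ is not an identity and $U\equiv u\to_T u$, gives $\mathsf{i}_{\dim T+1}[\{T,u\}\circ\sigma]$. A standard X-step is a standard reduction step given by clause X. Subscript r = reflexive closure, rt = reflexive transitive closure. -}

module Defs where

-- Raw syntax of Catt_su, well-scoped, with de Bruijn INDICES
-- (index zero = the last variable of the context).  Alpha-equivalence
-- is therefore plain syntactic identity of these trees.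

open import Data.Nat.Base using (ℕ; zero; suc; ⌊_/2⌋; _≡ᵇ_)
open import Data.Fin.Base using (Fin; zero; suc; toℕ)
open import Data.Bool.Base using (Bool; true; false; _∧_; if_then_else_)
open import Data.Maybe.Base using (Maybe; just; nothing; _<∣>_; _>>=_; maybe′) renaming (map to mapMaybe)
open import Data.List.Base using (List; []; _∷_; _++_) renaming (map to mapList)
open import Data.Product.Base using (_×_; _,_; proj₁; proj₂; ∃)
open import Relation.Binary.PropositionalEquality using (_≡_)
open import Relation.Binary.Core using (Rel)
open import Relation.Binary.Construct.Closure.Reflexive using (ReflClosure)
open import Relation.Binary.Construct.Closure.ReflexiveTransitive using (Star)
open import Relation.Binary.Construct.Composition using (_;_)
open import Relation.Binary.Construct.Union using (_∪_)

-- Syntax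
--   Ty n, Tm n : types / terms in a scope of n variables
--   Sub m n    : substitution from a context with m variables into
--                scope n (list of m terms; last entry = variable zero)
--   Ctx m      : contexts with m variables (snoc lists)

mutual
  data Ty : ℕ → Set where
    ⋆   : ∀ {n} → Ty n
    arr : ∀ {n} → Tm n → Ty n → Tm n → Ty n

  data Tm : ℕ → Set where
    var : ∀ {n} → Fin n → Tm n
    coh : ∀ {m n} → Ctx m → Ty m → Sub m n → Tm n

  data Sub : ℕ → ℕ → Set where
    ⟨⟩   : ∀ {n} → Sub 0 n
    _,,_ : ∀ {m n} → Sub m n → Tm n → Sub (suc m) n

  data Ctx : ℕ → Set where
    ∅   : Ctx 0
    _▸_ : ∀ {m} → Ctx m → Ty m → Ctx (suc m)

infixl 5 _,,_ _▸_

mutual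
  wkTm : ∀ {n} → Tm n → Tm (suc n)
  wkTm (var i) = var (suc i)
  wkTm (coh Γ A σ) = coh Γ A (wkSub σ)

  wkTy : ∀ {n} → Ty n → Ty (suc n)
  wkTy ⋆ = ⋆
  wkTy (arr s A t) = arr (wkTm s) (wkTy A) (wkTm t)

  wkSub : ∀ {m n} → Sub m n → Sub m (suc n)
  wkSub ⟨⟩ = ⟨⟩
  wkSub (σ ,, t) = wkSub σ ,, wkTm t

idSub : ∀ n → Sub n n
idSub zero = ⟨⟩
idSub (suc n) = wkSub (idSub n) ,, var zero

lookupS : ∀ {m n} → Sub m n → Fin m → Tm n
lookupS (σ ,, t) zero = t
lookupS (σ ,, t) (suc i) = lookupS σ i

mutual
  _[_]Tm : ∀ {m n} → Tm m → Sub m n → Tm n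
  var i [ σ ]Tm = lookupS σ i
  coh Γ A τ [ σ ]Tm = coh Γ A (τ ∘S σ)

  _[_]Ty : ∀ {m n} → Ty m → Sub m n → Ty n
  ⋆ [ σ ]Ty = ⋆
  arr s A t [ σ ]Ty = arr (s [ σ ]Tm) (A [ σ ]Ty) (t [ σ ]Tm)

  _∘S_ : ∀ {k m n} → Sub k m → Sub m n → Sub k n
  ⟨⟩ ∘S σ = ⟨⟩
  (τ ,, t) ∘S σ = (τ ∘S σ) ,, (t [ σ ]Tm)

mutual
  strTm : ∀ {n} → Tm (suc n) → Maybe (Tm n)
  strTm (var zero) = nothing
  strTm (var (suc i)) = just (var i)
  strTm (coh Γ A σ) = mapMaybe (coh Γ A) (strSub σ)

  strTy : ∀ {n} → Ty (suc n) → Maybe (Ty n)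
  strTy ⋆ = just ⋆
  strTy (arr s A t) = strTm s >>= λ s′ → strTy A >>= λ A′ → strTm t >>= λ t′ → just (arr s′ A′ t′)

  strSub : ∀ {m n} → Sub m (suc n) → Maybe (Sub m n)
  strSub ⟨⟩ = just ⟨⟩
  strSub (σ ,, t) = strSub σ >>= λ σ′ → strTm t >>= λ t′ → just (σ′ ,, t′)

-- Syntactic equality (≡ up to α, i.e. identity of de Bruijn trees),
-- as a Boolean test (heterogeneous in the scope indices; it returns
-- false whenever lengths of contexts / substitutions differ).

mutual
  eqTm : ∀ {n n′} → Tm n → Tm n′ → Bool
  eqTm (var i) (var j) = toℕ i ≡ᵇ toℕ j
  eqTm (coh Γ A σ) (coh Γ′ A′ σ′) = eqCtx Γ Γ′ ∧ (eqTy A A′ ∧ eqSub σ σ′)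
  eqTm _ _ = false

  eqTy : ∀ {n n′} → Ty n → Ty n′ → Bool
  eqTy ⋆ ⋆ = true
  eqTy (arr s A t) (arr s′ A′ t′) = eqTm s s′ ∧ (eqTy A A′ ∧ eqTm t t′)
  eqTy _ _ = false

  eqSub : ∀ {m n m′ n′} → Sub m n → Sub m′ n′ → Bool
  eqSub ⟨⟩ ⟨⟩ = true
  eqSub (σ ,, t) (σ′ ,, t′) = eqSub σ σ′ ∧ eqTm t t′
  eqSub _ _ = false

  eqCtx : ∀ {m m′} → Ctx m → Ctx m′ → Bool
  eqCtx ∅ ∅ = true
  eqCtx (Γ ▸ A) (Γ′ ▸ A′) = eqCtx Γ Γ′ ∧ eqTy A A′
  eqCtx _ _ = false

-- Dimension:  depth A = dim A + 1   (depth ⋆ = 0, i.e. dim ⋆ = -1)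

depth : ∀ {n} → Ty n → ℕ
depth ⋆ = 0
depth (arr s A t) = suc (depth A)

-- Discs and spheres.
--   ssz k = number of variables of (D^{k-1}, d'_{k-1})  (= 2k)
--   dsz k = number of variables of D^k                   (= 2k+1)
--   sphereTy k = S^{k-1}, in the context (D^{k-1}, d'_{k-1})
--   Disc k     = D^k

ssz : ℕ → ℕ
ssz zero = 0
ssz (suc k) = suc (suc (ssz k))

dsz : ℕ → ℕ
dsz k = suc (ssz k)

sphereTy : (k : ℕ) → Ty (ssz k)
sphereTy zero = ⋆
sphereTy (suc k) = arr (var (suc zero)) (wkTy (wkTy (sphereTy k))) (var zero)
  -- S^k = d_k →_{S^{k-1}} d'_k

Disc : (k : ℕ) → Ctx (dsz k)
Disc zero = ∅ ▸ ⋆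
Disc (suc k) = Disc k ▸ wkTy (sphereTy k) ▸ sphereTy (suc k)
  -- D^{k+1} = D^k , d'_k : S^{k-1} , d_{k+1} : S^k

idTy : (k : ℕ) → Ty (dsz k)
idTy k = arr (var zero) (wkTy (sphereTy k)) (var zero)

-- i_k[τ]  (note id_{D^k} ∘ τ ≡ τ, so i_k[τ] is coh(D^k : d_k → d_k)[τ])
identityTm : ∀ {n} (k : ℕ) → Sub (dsz k) n → Tm n
identityTm k τ = coh (Disc k) (idTy k) τ

-- "t is an identity": t ≡ i_k[τ] for some k, τ.  Since D^k has 2k+1
-- variables, the only candidate k for a coherence over m variables is ⌊m/2⌋.
isIdentity : ∀ {n} → Tm n → Bool
isIdentity (var _) = false
isIdentity (coh {m} Γ A τ) = eqCtx Γ (Disc ⌊ m /2⌋) ∧ eqTy A (idTy ⌊ m /2⌋)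

discSub : ∀ {n} (A : Ty n) → Tm n → Sub (dsz (depth A)) n
discSub ⋆ t = ⟨⟩ ,, t
discSub (arr u A v) t = discSub A u ,, v ,, t

-- We run the (unique) linear pasting derivation from left to right.
-- State after a prefix: the derivation ends with  Γ ⊢p cur : curTy;
-- lmax = locally maximal variables found so far (left to right);
-- fresh = just f iff the last step was the introduction of f.

record PState (m : ℕ) : Set where
  constructor pst
  field
    cur   : Tm m
    curTy : Ty m
    lmax  : List (Fin m)
    fresh : Maybe (Fin m)

-- descend from (x : A) by descent steps until the type is A′;
-- the Bool records whether at least one descent step was made.
descend : ∀ {m} → Tm m → Ty m → Ty m → Maybe (Tm m × Bool)
descend {m} x ⋆ A′ = if eqTy (⋆ {m}) A′ then just (x , false) else nothing
descend x (arr s B t) A′ =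
  if eqTy (arr s B t) A′ then just (x , false)
  else mapMaybe (λ p → proj₁ p , true) (descend t B A′)

-- a freshly introduced variable followed by a descent step is locally maximal
newLM : ∀ {m} → Maybe (Fin m) → Bool → List (Fin m)
newLM (just f) true = f ∷ []
newLM _ _ = []

-- introduction step  Γ ⊢p x : A  ⟹  Γ, y : A, f : x →_A y ⊢p f : x →_A y
-- (preceded by the descents needed to reach the type A of y)
psIntro : ∀ {m} → Ty m → Ty (suc m) → PState m → Maybe (PState (suc (suc m)))
psIntro A B (pst x T L fr) =
  descend x T A >>= λ p →
  if eqTy B (arr (wkTm (proj₁ p)) (wkTy A) (var zero))
  then just (pst (var zero) (wkTy B)
                 (mapList (λ i → suc (suc i)) (L ++ newLM fr (proj₂ p)))
                 (just zero))
  else nothing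

psState : ∀ {m} → Ctx m → Maybe (PState m)
psState ∅ = nothing
psState (∅ ▸ A) = if eqTy A (⋆ {0}) then just (pst (var zero) ⋆ [] nothing) else nothing
psState (Γ ▸ A ▸ B) = psState Γ >>= psIntro A B

-- Locally maximal variables of Γ, left to right (empty if Γ is not a
-- pasting context).  At the end, the derivation descends to a variable
-- of type ⋆; if the last step was an introduction, that variable is
-- therefore followed by a descent.
locMax : ∀ {m} → Ctx m → List (Fin m)
locMax Γ = maybe′ (λ s → PState.lmax s ++ newLM (PState.fresh s) true) [] (psState Γ)

-- Pruning a locally maximal variable α : s →_A t of Γ:
--   ctx   = Γ//α   (t, α deleted; later types transported along π_α,
--                   i.e. t replaced by s)
--   proj  = π_α : α ↦ i_{dim A+1}[{A,s}], t ↦ s, others fixed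
--   dropS = σ ↦ σ//α  (entries for t, α removed)

record Pruned (m : ℕ) : Set where
  constructor pruned
  field
    size  : ℕ
    ctx   : Ctx size
    proj  : Sub m size
    dropS : ∀ {n} → Sub m n → Sub size n

pruneLast : ∀ {m} → Ctx m → Ty m → Maybe (Pruned (suc m))
pruneLast ∅ _ = nothing
pruneLast (Γ₀ ▸ At) ⋆ = nothing
pruneLast {suc k} (Γ₀ ▸ At) (arr s A t) =
  strTm s >>= λ s₀ → strTy A >>= λ A₀ →
  just (pruned k Γ₀
          (idSub k ,, s₀ ,, identityTm (depth A₀) (discSub A₀ s₀))
          (λ { (σ ,, _ ,, _) → σ }))

pruneExt : ∀ {m} → Ty m → Pruned m → Pruned (suc m)
pruneExt B (pruned k Γ′ π d) =
  pruned (suc k) (Γ′ ▸ (B [ π ]Ty)) (wkSub π ,, var zero) (λ { (σ ,, u) → d σ ,, u })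

prune : ∀ {m} → Ctx m → Fin m → Maybe (Pruned m)
prune (Γ ▸ A) zero = pruneLast Γ A
prune (Γ ▸ B) (suc j) = mapMaybe (pruneExt B) (prune Γ j)

findLM : ∀ {m n} → List (Fin m) → Sub m n → Maybe (Fin m)
findLM [] σ = nothing
findLM (x ∷ xs) σ = if isIdentity (lookupS σ x) then just x else findLM xs σ

lastS : ∀ {m n} → Sub m n → Maybe (Tm n)
lastS ⟨⟩ = nothing
lastS (σ ,, t) = just t

-- Standard reduction (partial function), recording the clause used at
-- the root of a term.

data Rule : Set where
  rA rB rC rD rE : Rule

clauseB : ∀ {m n} → Ctx m → Ty m → Sub m n → Maybe (Rule × Tm n)
clauseB Γ U σ =
  if isIdentity (coh Γ U σ) then nothing
  else (findLM (locMax Γ) σ >>= λ x → prune Γ x >>= λ P →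
        just (rB , coh (Pruned.ctx P) (U [ Pruned.proj P ]Ty) (Pruned.dropS P σ)))

clauseD′ : ∀ {m n} → ℕ → Ctx m → Ty m → Sub m n → Maybe (Rule × Tm n)
clauseD′ zero Γ U σ = nothing
clauseD′ (suc k) Γ U σ =
  if eqCtx Γ (Disc (suc k)) ∧ eqTy U (wkTy (sphereTy (suc k)))
  then mapMaybe (rD ,_) (lastS σ) else nothing

-- Γ ≡ D^{k+1} forces m = 2k+3, i.e. k+1 = ⌊m/2⌋
clauseD : ∀ {m n} → Ctx m → Ty m → Sub m n → Maybe (Rule × Tm n)
clauseD {m} = clauseD′ ⌊ m /2⌋

clauseE′ : ∀ {m n} → Ty m → Sub m n → Maybe (Rule × Tm n)
clauseE′ ⋆ σ = nothing
clauseE′ (arr u T v) σ =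
  if eqTm u v then just (rE , identityTm (depth T) (discSub T u ∘S σ)) else nothing

clauseE : ∀ {m n} → Ctx m → Ty m → Sub m n → Maybe (Rule × Tm n)
clauseE Γ U σ = if isIdentity (coh Γ U σ) then nothing else clauseE′ U σ

mutual
  redTy : ∀ {n} → Ty n → Maybe (Ty n)
  redTy ⋆ = nothing
  redTy (arr s A t) =
        mapMaybe (λ A′ → arr s A′ t) (redTy A)
    <∣> mapMaybe (λ p → arr (proj₂ p) A t) (redTm s)
    <∣> mapMaybe (λ p → arr s A (proj₂ p)) (redTm t)

  redSub : ∀ {m n} → Sub m n → Maybe (Sub m n)
  redSub ⟨⟩ = nothing
  redSub (σ ,, t) =
        mapMaybe (λ σ′ → σ′ ,, t) (redSub σ)
    <∣> mapMaybe (λ p → σ ,, proj₂ p) (redTm t)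

  redTm : ∀ {n} → Tm n → Maybe (Rule × Tm n)
  redTm (var x) = nothing
  redTm (coh Γ U σ) =
        mapMaybe (λ σ′ → rA , coh Γ U σ′) (redSub σ)
    <∣> clauseB Γ U σ
    <∣> mapMaybe (λ U′ → rC , coh Γ U′ σ) (redTy U)
    <∣> clauseD Γ U σ
    <∣> clauseE Γ U σ

StdStep : ∀ {n} → Rel (Tm n) _
StdStep t t′ = ∃ λ r → redTm t ≡ just (r , t′)

RuleStep : ∀ {n} → Rule → Rel (Tm n) _
RuleStep r t t′ = redTm t ≡ just (r , t′)

Composite : ∀ {n} → Rel (Tm n) _
Composite =
  Star (RuleStep rA) ; (Star (RuleStep rB) ; (Star (RuleStep rC) ;
    (ReflClosure (RuleStep rD) ∪ (ReflClosure (RuleStep rE) ; Star (RuleStep rA)))))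

module Submission where

-- A standard step of  coh(Γ : U)[σ]  is given by the FIRST applicable clause,
-- so its shape is controlled by three facts about the term:
--   * whether σ is in normal form (otherwise the step is an A-step);
--   * whether clause B applies (otherwise, for normal σ, a C-, D- or E-step);
--   * whether U reduces (a C-step) or not (a D- or E-step).
-- The proof of  ↣rt ⊆ Composite  follows a reduction sequence through these
-- phases, using invariants established first:
--   (1) a B-step yields a coherence whose substitution is still normal
--       (pruning only deletes entries);
--   (2) a C-step keeps σ normal and clause B inapplicable (B only depends on
--       U through "is an identity", and identities have normal types);
--   (3) a D-step yields the last entry of a normal σ, a normal term;
--   (4) an E-step yields an identity, and identities only take A-steps.

open import Defs
open import Data.Product.Base using (_×_)
open import Relation.Binary.Core using (_⇒_)
open import Relation.Binary.Construct.Closure.ReflexiveTransitive using (Star)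

open import Data.Nat.Base using (ℕ; zero; suc; ⌊_/2⌋)
open import Data.Nat.Properties using (≡⇒≡ᵇ)
open import Data.Fin.Base using (Fin; zero; suc; toℕ)
open import Data.Bool.Base using (true; false; _∧_)
open import Data.Bool.Properties using (T-≡)
open import Function.Bundles using (Equivalence)
open import Data.Maybe.Base using (just; nothing; _<∣>_) renaming (map to mapMaybe)
open import Data.Product.Base using (_,_; proj₁; proj₂; Σ; ∃)
open import Data.Sum.Base using (inj₁; inj₂)
open import Relation.Binary.PropositionalEquality using (_≡_; refl; sym; trans; cong)
open import Relation.Binary.Construct.Closure.ReflexiveTransitive using (ε; _◅_; _◅◅_; return) renaming (map to mapStar)
open import Relation.Binary.Construct.Closure.Reflexive using (ReflClosure; [_]) renaming (refl to none)
open import Relation.Binary.Construct.Composition using (_;_)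
open import Relation.Binary.Construct.Union using (_∪_)

NormalTm : ∀ {n} → Tm n → Set
NormalTm t = redTm t ≡ nothing

NormalSub : ∀ {m n} → Sub m n → Set
NormalSub σ = redSub σ ≡ nothing

mutual
  eqTm-refl : ∀ {n} (t : Tm n) → eqTm t t ≡ true
  eqTm-refl (var i) = Equivalence.to T-≡ (≡⇒≡ᵇ (toℕ i) (toℕ i) refl)
  eqTm-refl (coh Γ A σ) rewrite eqCtx-refl Γ | eqTy-refl A | eqSub-refl σ = refl

  eqTy-refl : ∀ {n} (A : Ty n) → eqTy A A ≡ true
  eqTy-refl ⋆ = refl
  eqTy-refl (arr s A t) rewrite eqTm-refl s | eqTy-refl A | eqTm-refl t = refl

  eqSub-refl : ∀ {m n} (σ : Sub m n) → eqSub σ σ ≡ true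
  eqSub-refl ⟨⟩ = refl
  eqSub-refl (σ ,, t) rewrite eqSub-refl σ | eqTm-refl t = refl

  eqCtx-refl : ∀ {m} (Γ : Ctx m) → eqCtx Γ Γ ≡ true
  eqCtx-refl ∅ = refl
  eqCtx-refl (Γ ▸ A) rewrite eqCtx-refl Γ | eqTy-refl A = refl

-- The disc D^k has 2k+1 variables, so the identity test recovers k.
half-dsz : ∀ k → ⌊ dsz k /2⌋ ≡ k
half-dsz zero = refl
half-dsz (suc k) = cong suc (half-dsz k)

identityTm-isIdentity : ∀ {n} k (τ : Sub (dsz k) n) → isIdentity (identityTm k τ) ≡ true
identityTm-isIdentity k τ rewrite half-dsz k | eqCtx-refl (Disc k) | eqTy-refl (idTy k) = refl

data VarTy {n} : Ty n → Set where
  ⋆-var   : VarTy ⋆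
  arr-var : ∀ {i j A} → VarTy A → VarTy (arr (var i) A (var j))

VarTy-wk : ∀ {n} {A : Ty n} → VarTy A → VarTy (wkTy A)
VarTy-wk ⋆-var = ⋆-var
VarTy-wk (arr-var v) = arr-var (VarTy-wk v)

VarTy-sphere : ∀ k → VarTy (sphereTy k)
VarTy-sphere zero = ⋆-var
VarTy-sphere (suc k) = arr-var (VarTy-wk (VarTy-wk (VarTy-sphere k)))

VarTy-idTy : ∀ k → VarTy (idTy k)
VarTy-idTy k = arr-var (VarTy-wk (VarTy-sphere k))

eqTm-var : ∀ {n n′} (s : Tm n) (j : Fin n′) → eqTm s (var j) ≡ true → ∃ λ i → s ≡ var i
eqTm-var (var i) j _ = i , refl

VarTy-eqTy : ∀ {n n′} (A : Ty n) {A′ : Ty n′} → eqTy A A′ ≡ true → VarTy A′ → VarTy A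
VarTy-eqTy ⋆ _ ⋆-var = ⋆-var
VarTy-eqTy (arr s A t) {arr (var i) A′ (var j)} e (arr-var v)
  with eqTm s (var i) in es | eqTy A A′ in eA
... | true | true with eqTm-var s i es | eqTm-var t j e
...   | _ , refl | _ , refl = arr-var (VarTy-eqTy A eA v)

VarTy-normal : ∀ {n} {A : Ty n} → VarTy A → redTy A ≡ nothing
VarTy-normal ⋆-var = refl
VarTy-normal (arr-var v) rewrite VarTy-normal v = refl

isIdentity-normalTy : ∀ {m n} (Γ : Ctx m) U (σ : Sub m n) →
                      isIdentity (coh Γ U σ) ≡ true → redTy U ≡ nothing
isIdentity-normalTy {m} Γ U σ e with eqCtx Γ (Disc ⌊ m /2⌋)
... | true = VarTy-normal (VarTy-eqTy U e (VarTy-idTy ⌊ m /2⌋))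

NormalSub-split : ∀ {m n} (σ : Sub m n) t → NormalSub (σ ,, t) → NormalSub σ × NormalTm t
NormalSub-split σ t e with redSub σ
... | nothing with redTm t
...   | nothing = refl , refl

NormalSub-last : ∀ {m n} (σ : Sub m n) {u} → NormalSub σ → lastS σ ≡ just u → NormalTm u
NormalSub-last (σ ,, t) e refl = proj₂ (NormalSub-split σ t e)

-- σ//x only deletes entries of σ, hence preserves normality.
prune-NormalSub : ∀ {m} (Γ : Ctx m) (x : Fin m) {P} → prune Γ x ≡ just P →
                  ∀ {n} (σ : Sub m n) → NormalSub σ → NormalSub (Pruned.dropS P σ)
prune-NormalSub (Γ₀ ▸ At ▸ arr s A t) zero eq σ e with strTm s
... | just s₀ with strTy A
prune-NormalSub (Γ₀ ▸ At ▸ arr s A t) zero refl (σ ,, a ,, b) e | just s₀ | just A₀ =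
  proj₁ (NormalSub-split σ a (proj₁ (NormalSub-split (σ ,, a) b e)))
prune-NormalSub (Γ ▸ B) (suc j) eq σ e with prune Γ j in ep
prune-NormalSub (Γ ▸ B) (suc j) refl (σ ,, u) e | just _ with NormalSub-split σ u e
... | eσ , eu rewrite prune-NormalSub Γ j ep σ eσ | eu = refl

record NormalCoh {n} (t : Tm n) : Set where
  constructor normalCoh
  field
    {size} : ℕ
    ctx    : Ctx size
    ty     : Ty size
    sub    : Sub size n
    shape  : t ≡ coh ctx ty sub
    normal : NormalSub sub

clauseB-result : ∀ {m n} (Γ : Ctx m) U (σ : Sub m n) {r t′} → NormalSub σ →
                 clauseB Γ U σ ≡ just (r , t′) → r ≡ rB × NormalCoh t′
clauseB-result Γ U σ nf eq with isIdentity (coh Γ U σ)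
... | false with findLM (locMax Γ) σ
...   | just x with prune Γ x in ep
clauseB-result Γ U σ nf refl | false | just x | just P =
  refl , normalCoh _ _ _ refl (prune-NormalSub Γ x ep σ nf)

clauseB-afterC : ∀ {m n} (Γ : Ctx m) U U′ (σ : Sub m n) → clauseB Γ U σ ≡ nothing →
                 redTy U ≡ just U′ → clauseB Γ U′ σ ≡ nothing
clauseB-afterC Γ U U′ σ noB eU with isIdentity (coh Γ U σ) in eI
... | true with () <- trans (sym eU) (isIdentity-normalTy Γ U σ eI)
... | false with isIdentity (coh Γ U′ σ)
...   | true = refl
...   | false with findLM (locMax Γ) σ
...     | nothing = refl
...     | just x with prune Γ x
...       | nothing = refl

clauseD-result : ∀ {m n} (Γ : Ctx m) U (σ : Sub m n) {r t′} →
                 clauseD Γ U σ ≡ just (r , t′) → r ≡ rD × lastS σ ≡ just t′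
clauseD-result {m} Γ U σ eq with ⌊ m /2⌋
... | suc k with eqCtx Γ (Disc (suc k)) ∧ eqTy U (wkTy (sphereTy (suc k)))
...   | true with lastS σ
...     | just u with refl <- eq = refl , refl

clauseE-result : ∀ {m n} (Γ : Ctx m) U (σ : Sub m n) {r t′} → clauseE Γ U σ ≡ just (r , t′) →
                 r ≡ rE × Σ ℕ λ k → Σ (Sub (dsz k) n) λ τ → t′ ≡ identityTm k τ
clauseE-result Γ U σ eq with isIdentity (coh Γ U σ)
clauseE-result Γ (arr u T v) σ eq | false with eqTm u v
clauseE-result Γ (arr u T v) σ refl | false | true = refl , _ , _ , refl

-- A standard step of coh(Γ : U)[σ], classified by the first applicable clause;
-- the three views correspond to the successive phases of the theorem.
module _ {m n} (Γ : Ctx m) (U : Ty m) (σ : Sub m n) where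

  data FinalStep : Rule → Tm n → Set where
    byC : ∀ {U′} → redTy U ≡ just U′ → FinalStep rC (coh Γ U′ σ)
    byD : ∀ {t′} → clauseD Γ U σ ≡ just (rD , t′) → FinalStep rD t′
    byE : ∀ {t′} → clauseE Γ U σ ≡ just (rE , t′) → FinalStep rE t′

  data StepAfterA : Rule → Tm n → Set where
    byB    : ∀ {t′} → clauseB Γ U σ ≡ just (rB , t′) → StepAfterA rB t′
    afterB : ∀ {r t′} → clauseB Γ U σ ≡ nothing → FinalStep r t′ → StepAfterA r t′

  data CohStep : Rule → Tm n → Set where
    byA    : ∀ {σ′} → redSub σ ≡ just σ′ → CohStep rA (coh Γ U σ′)
    afterA : ∀ {r t′} → NormalSub σ → StepAfterA r t′ → CohStep r t′

  -- The view functions unfold  redTm  one clause at a time; each argument is the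
  -- remainder of the clause chain once the earlier clauses have failed.
  finalStep : ∀ {r t′} → (mapMaybe (λ U′ → rC , coh Γ U′ σ) (redTy U)
                          <∣> clauseD Γ U σ <∣> clauseE Γ U σ) ≡ just (r , t′) →
              FinalStep r t′
  finalStep step with redTy U in eU
  ... | just _ with refl <- step = byC eU
  ... | nothing with clauseD Γ U σ in eD
  ...   | just (r , _) with refl <- step | refl <- proj₁ (clauseD-result Γ U σ eD) = byD eD
  finalStep step | nothing | nothing with refl <- proj₁ (clauseE-result Γ U σ step) = byE step

  stepAfterA : ∀ {r t′} → NormalSub σ → (clauseB Γ U σ
                 <∣> mapMaybe (λ U′ → rC , coh Γ U′ σ) (redTy U)
                 <∣> clauseD Γ U σ <∣> clauseE Γ U σ) ≡ just (r , t′) →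
               StepAfterA r t′
  stepAfterA nf step with clauseB Γ U σ in eB
  ... | just _ with refl <- step | refl <- proj₁ (clauseB-result Γ U σ nf eB) = byB eB
  ... | nothing = afterB eB (finalStep step)

  cohStep : ∀ {r t′} → redTm (coh Γ U σ) ≡ just (r , t′) → CohStep r t′
  cohStep step with redSub σ in eσ
  ... | just _ with refl <- step = byA eσ
  ... | nothing = afterA eσ (stepAfterA eσ step)

normal-Star : ∀ {n} {t u : Tm n} → NormalTm t → Star StdStep t u → t ≡ u
normal-Star _ ε = refl
normal-Star nf ((_ , step) ◅ _) with () <- trans (sym nf) step

-- An identity with normal substitution is normal: B and E exclude identities,
-- its type is normal, and D fails since d_k → d_k is not a sphere.
identity-normal : ∀ {n} k (τ : Sub (dsz k) n) → NormalSub τ → NormalTm (identityTm k τ)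
identity-normal k τ nf
  rewrite nf | identityTm-isIdentity k τ | VarTy-normal (VarTy-idTy k) | half-dsz k with k
... | zero = refl
... | suc k′ rewrite eqCtx-refl (Disc (suc k′)) = refl

identity-Star : ∀ {n} k (τ : Sub (dsz k) n) {u} →
                Star StdStep (identityTm k τ) u → Star (RuleStep rA) (identityTm k τ) u
identity-Star k τ ε = ε
identity-Star k τ ((_ , step) ◅ rest) with cohStep (Disc k) (idTy k) τ step
... | byA _ = step ◅ identity-Star k _ rest
... | afterA nf _ with () <- trans (sym (identity-normal k τ nf)) step

module _ {n : ℕ} where

  Tail FromC FromB : Tm n → Tm n → Set
  Tail  = ReflClosure (RuleStep rD) ∪ (ReflClosure (RuleStep rE) ; Star (RuleStep rA))
  FromC = Star (RuleStep rC) ; Tail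
  FromB = Star (RuleStep rB) ; FromC

  fromC : ∀ {m} (Γ : Ctx m) U (σ : Sub m n) {u} → NormalSub σ → clauseB Γ U σ ≡ nothing →
          Star StdStep (coh Γ U σ) u → FromC (coh Γ U σ) u
  fromC Γ U σ nf noB ε = _ , ε , inj₁ none
  fromC Γ U σ nf noB ((_ , step) ◅ rest) with cohStep Γ U σ step
  ... | byA e with () <- trans (sym nf) e
  ... | afterA _ (byB e) with () <- trans (sym noB) e
  ... | afterA _ (afterB _ (byC e)) with fromC Γ _ σ nf (clauseB-afterC Γ U _ σ noB e) rest
  ...   | _ , cs , tail = _ , step ◅ cs , tail
  fromC Γ U σ nf noB ((_ , step) ◅ rest) | afterA _ (afterB _ (byD e))
    with proj₂ (clauseD-result Γ U σ e)
  ... | eLast with refl <- normal-Star (NormalSub-last σ nf eLast) rest = _ , ε , inj₁ [ step ]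
  fromC Γ U σ nf noB ((_ , step) ◅ rest) | afterA _ (afterB _ (byE e))
    with proj₂ (clauseE-result Γ U σ e)
  ... | k , τ , refl = _ , ε , inj₂ (_ , [ step ] , identity-Star k τ rest)

  fromB : ∀ {m} (Γ : Ctx m) U (σ : Sub m n) {u} → NormalSub σ →
          Star StdStep (coh Γ U σ) u → FromB (coh Γ U σ) u
  fromB Γ U σ nf ε = _ , ε , _ , ε , inj₁ none
  fromB Γ U σ nf ((r , step) ◅ rest) with cohStep Γ U σ step
  ... | byA e with () <- trans (sym nf) e
  ... | afterA _ (afterB noB _) = _ , ε , fromC Γ U σ nf noB ((r , step) ◅ rest)
  ... | afterA _ (byB e) with proj₂ (clauseB-result Γ U σ nf e)
  ...   | normalCoh Γ′ U′ σ′ refl nf′ with fromB Γ′ U′ σ′ nf′ rest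
  ...     | _ , bs , fc = _ , step ◅ bs , fc

  stdStar⇒composite : Star (StdStep {n}) ⇒ Composite
  stdStar⇒composite ε = _ , ε , _ , ε , _ , ε , inj₁ none
  stdStar⇒composite {var _} ((_ , ()) ◅ _)
  stdStar⇒composite {coh Γ U σ} ((r , step) ◅ rest) with cohStep Γ U σ step
  ... | afterA nf _ = _ , ε , fromB Γ U σ nf ((r , step) ◅ rest)
  ... | byA _ with stdStar⇒composite rest
  ...   | _ , as , fb = _ , step ◅ as , fb

  ruleStar⇒stdStar : ∀ {r} → Star (RuleStep {n} r) ⇒ Star StdStep
  ruleStar⇒stdStar {r} = mapStar (r ,_)

  ruleRefl⇒stdStar : ∀ {r} → ReflClosure (RuleStep {n} r) ⇒ Star StdStep
  ruleRefl⇒stdStar none = ε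
  ruleRefl⇒stdStar {r} [ step ] = return (r , step)

  composite⇒stdStar : Composite {n} ⇒ Star StdStep
  composite⇒stdStar (_ , as , _ , bs , _ , cs , tail) =
    ruleStar⇒stdStar as ◅◅ ruleStar⇒stdStar bs ◅◅ ruleStar⇒stdStar cs ◅◅ tailSteps tail
    where
    tailSteps : ∀ {t u} → Tail t u → Star StdStep t u
    tailSteps (inj₁ d) = ruleRefl⇒stdStar d
    tailSteps (inj₂ (_ , e , as′)) = ruleRefl⇒stdStar e ◅◅ ruleStar⇒stdStar as′

mainTheorem11 : ∀ {n} → (Star (StdStep {n}) ⇒ Composite {n}) × (Composite {n} ⇒ Star (StdStep {n}))
mainTheorem11 = stdStar⇒composite , composite⇒stdStar
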